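{- For every clause $C$ (interpreted as an XOR-clause) we have $X_1(C)\in\mathcal{PC}$.
   Context: Literals, clauses (finite sets of literals without complementary pairs), clause-sets (finite sets of clauses); $\mathrm{var}$. Partial assignments $\varphi$ and application $\varphi*F$ (delete satisfied clauses and falsified literals); a literal $x$ is forced for $F$ if $\langle x\to0\rangle*F$ is unsatisfiable. $r_1$ is unit-clause propagation; $r_\infty(F)$ is $\{\bot\}$ if $F$ is unsatisfiable, otherwise the result of applying all forced assignments. $\mathcal{PC}$ is the class of clause-sets $G$ such that for every partial assignment $\varphi$, $r_1(\varphi*G)=r_\infty(\varphi*G)$. XOR-clause: a clause $C$ read as $\bigoplus_{x\in C}x=0$ over $\mathbb{Z}_2$. $X_0(C)$ is the set of all clauses $D$ with $\mathrm{var}(D)=\mathrm{var}(C)$ whose number of complemented literals has parity different from that of $C$; $X_0$ of an XOR-clause-set is the union over its clauses. Natural splitting of $C=\{x_1,\dots,x_n\}$: $\{C\}$ if $n\le2$; otherwise, with new distinct variables $y_2,\dots,y_{n-1}\notin\mathrm{var}(C)$, the XOR-clause-set $\{\{x_1,x_2,y_2\}\}\cup\{\{y_{i-1},x_i,y_i\}:3\le i\le n-1\}\cup\{\{y_{n-1},x_n\}\}$. $X_1(C)$ is $X_0$ of the natural splitting. -}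

module Defs where

open import Data.Nat using (ℕ; zero; suc; _≡ᵇ_)
open import Data.Bool using (Bool; true; false; not; _xor_; if_then_else_; _∧_; _∨_)
open import Data.Maybe using (Maybe; just; nothing)
open import Data.List using (List; []; _∷_; map; filterᵇ; length; null; concatMap; foldr)
open import Data.Bool.ListAction using (any)
open import Data.List.Membership.Propositional using (_∈_)
open import Data.List.Relation.Unary.All using (All)
open import Data.List.Relation.Unary.Any using (Any)
open import Data.Product using (Σ; _×_; ∃)
open import Data.Sum using (_⊎_)
open import Relation.Nullary using (¬_)
open import Relation.Binary.PropositionalEquality using (_≡_)
open import Function.Bundles using (_⇔_)

-- Literals, clauses, clause-sets
-- Variables are natural numbers.  A literal is a variable together with
-- a flag telling whether it is complemented (neg = true means ¬v).

record Lit : Set where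
  constructor mkLit
  field
    var : ℕ
    neg : Bool
open Lit public

pos : ℕ → Lit
pos v = mkLit v false

-- Clauses and clause-sets are represented by lists, read as finite sets
-- (equality of clause-sets is set equality, see _≐_ below).
Clause : Set
Clause = List Lit

ClauseSet : Set
ClauseSet = List Clause

vars : Clause → List ℕ
vars = map var

⊥c : Clause
⊥c = []

⊥set : ClauseSet
⊥set = ⊥c ∷ []

_≈c_ : Clause → Clause → Set
C ≈c D = (∀ {x} → x ∈ C → x ∈ D) × (∀ {x} → x ∈ D → x ∈ C)

_≐_ : ClauseSet → ClauseSet → Set
F ≐ G = (∀ {C} → C ∈ F → Any (C ≈c_) G) × (∀ {D} → D ∈ G → Any (D ≈c_) F)

PAss : Set
PAss = ℕ → Maybe Bool

litVal : PAss → Lit → Maybe Bool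
litVal φ x with φ (var x)
... | just b  = just (b xor neg x)
... | nothing = nothing

isTrue : Maybe Bool → Bool
isTrue (just true) = true
isTrue _           = false

isFalse : Maybe Bool → Bool
isFalse (just false) = true
isFalse _            = false

_*_ : PAss → ClauseSet → ClauseSet
φ * F = map (filterᵇ (λ x → not (isFalse (litVal φ x))))
            (filterᵇ (λ C → not (any (λ x → isTrue (litVal φ x)) C)) F)

⟨_↦1⟩ : Lit → PAss
⟨ x ↦1⟩ v = if v ≡ᵇ var x then just (not (neg x)) else nothing

⟨_↦0⟩ : Lit → PAss
⟨ x ↦0⟩ v = if v ≡ᵇ var x then just (neg x) else nothing

TrueLit : (ℕ → Bool) → Lit → Set
TrueLit f x = (f (var x) xor neg x) ≡ true

Satisfies : (ℕ → Bool) → ClauseSet → Set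
Satisfies f F = All (Any (TrueLit f)) F

Sat : ClauseSet → Set
Sat F = ∃ λ (f : ℕ → Bool) → Satisfies f F

Unsat : ClauseSet → Set
Unsat F = ¬ Sat F

Forced : ClauseSet → Lit → Set
Forced F x = Unsat (⟨ x ↦0⟩ * F)

-- ψ is the partial assignment applying all forced assignments of F:
-- ψ assigns v ↦ b exactly when the literal "v = b" is forced.
IsForcedAss : ClauseSet → PAss → Set
IsForcedAss F ψ = ∀ (v : ℕ) (b : Bool) → (ψ v ≡ just b) ⇔ Forced F (mkLit v (not b))

-- r_1 : unit-clause propagation
--   r1(F) = ⊥set            if ⊥ ∈ F
--   r1(F) = r1(⟨x→1⟩ * F)  if {x} ∈ F
--   r1(F) = F              otherwise
-- Each propagation step removes at least the unit clause, so
-- length F + 1 steps of fuel always suffice.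

findUnit : ClauseSet → Maybe Lit
findUnit []                  = nothing
findUnit ((x ∷ []) ∷ F)      = just x
findUnit (_ ∷ F)             = findUnit F

r1-fuel : ℕ → ClauseSet → ClauseSet
r1-fuel zero    F = F
r1-fuel (suc k) F with any null F
... | true  = ⊥set
... | false with findUnit F
...   | just x  = r1-fuel k (⟨ x ↦1⟩ * F)
...   | nothing = F

r1 : ClauseSet → ClauseSet
r1 F = r1-fuel (suc (length F)) F

RInfIs : ClauseSet → ClauseSet → Set
RInfIs F H = (Unsat F × H ≐ ⊥set)
           ⊎ (Sat F × Σ PAss λ ψ → IsForcedAss F ψ × H ≐ (ψ * F))

PC : ClauseSet → Set
PC G = ∀ (φ : PAss) → RInfIs (φ * G) (r1 (φ * G))

parity : Clause → Bool
parity = foldr (λ x p → neg x xor p) false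

allClauses : List ℕ → List Clause
allClauses []       = [] ∷ []
allClauses (v ∷ vs) = concatMap (λ D → (mkLit v false ∷ D) ∷ (mkLit v true ∷ D) ∷ []) (allClauses vs)

X0c : Clause → ClauseSet
X0c C = filterᵇ (λ D → parity D xor parity C) (allClauses (vars C))

X0 : List Clause → ClauseSet
X0 = concatMap X0c

-- natural splitting of C = {x1,...,xn} using new variables ys = y2,...,y_{n-1}
splitChain : ℕ → List Lit → List ℕ → List Clause
splitChain y (x ∷ [])     []        = (pos y ∷ x ∷ []) ∷ []
splitChain y (x ∷ xs)     (y' ∷ ys) = (pos y ∷ x ∷ pos y' ∷ []) ∷ splitChain y' xs ys
splitChain y _            _         = []   -- length mismatch: excluded by hypotheses

natSplit : Clause → List ℕ → List Clause
natSplit (x1 ∷ x2 ∷ x3 ∷ xs) (y2 ∷ ys) = (x1 ∷ x2 ∷ pos y2 ∷ []) ∷ splitChain y2 (x3 ∷ xs) ys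
natSplit (x1 ∷ x2 ∷ x3 ∷ xs) []        = []   -- length mismatch: excluded by hypotheses
natSplit C                   _         = C ∷ []   -- n ≤ 2

X1 : Clause → List ℕ → ClauseSet
X1 C ys = X0 (natSplit C ys)

-- Run r₁ on φ * X₁(C).  Every total assignment that extends φ and satisfies X₁(C) also extends
-- each assignment r₁ makes, so if r₁ derives ⊥ the clause-set is unsatisfiable.  Otherwise r₁
-- stops at some φ′ leaving no empty and no unit clause.  As X₀(D) consists of the clauses
-- falsified by the assignments violating D, every XOR-clause D of the splitting with at most one
-- variable free under φ′ is then satisfied by every extension of φ′.  The splitting is a chain of
-- XOR-clauses, each sharing a single variable with the rest, so solutions can be glued along that
-- variable: every variable free under φ′ takes either value in some solution.  Hence nothing
-- beyond φ′ is forced, and r₁ computes r∞.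

module Submission where

open import Defs
open import Data.Bool using (Bool; true; false; not; _xor_; _∨_; if_then_else_; T)
import Data.Bool as Bool
open import Data.Bool.ListAction using (any; or)
open import Data.Bool.Properties using (∨-zeroʳ; xor-same; not-distribˡ-xor; not-distribʳ-xor; ¬-not; not-¬)
open import Data.Empty using (⊥; ⊥-elim)
open import Data.List using (List; []; _∷_; _++_; map; filterᵇ; length; null; foldr; concatMap)
open import Data.List.Membership.Propositional using (_∈_; _∉_; find; lose)
open import Data.List.Membership.Propositional.Properties
  using (∈-filter⁺; ∈-filter⁻; ∈-concatMap⁺; ∈-concatMap⁻; ∈-map⁺; ∈-++⁺ˡ; ∈-++⁺ʳ)
open import Data.List.Properties using (map-cong; map-cong-local; map-∘; filter-≐; filter-notAll; length-map)
open import Data.List.Relation.Unary.All using (All; []; _∷_)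
import Data.List.Relation.Unary.All as All
import Data.List.Relation.Unary.All.Properties as All
open import Data.List.Relation.Unary.All.Properties using (¬Any⇒All¬; All¬⇒¬Any)
open import Data.List.Relation.Unary.AllPairs using ([]; _∷_)
open import Data.List.Relation.Unary.Any using (Any; here; there)
import Data.List.Relation.Unary.Any as Any
import Data.List.Relation.Unary.Any.Properties as Any
open import Data.List.Relation.Unary.Unique.Propositional using (Unique)
open import Data.List.Relation.Unary.Unique.Propositional.Properties using (filter⁺)
open import Data.Maybe using (Maybe; just; nothing; _<∣>_; fromMaybe; is-nothing)
open import Data.Maybe.Properties using (just-injective)
open import Data.Nat using (ℕ; suc; _≡ᵇ_; _<_; _≤_; s≤s; z≤n; _≟_; _∸_)
open import Data.Nat.Properties using (suc-injective; ≡ᵇ⇒≡; ≡⇒≡ᵇ; <-≤-trans; ≤-pred; ≤-refl)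
open import Data.List.Membership.DecPropositional _≟_ using (_∈?_)
open import Data.Product using (_×_; _,_; proj₁; proj₂)
open import Data.Sum using (_⊎_; inj₁; inj₂)
open import Function using (_∘_; case_of_)
open import Function.Bundles using (mk⇔)
open import Relation.Nullary using (¬_; ¬?; Dec; yes; no; does)
open import Relation.Nullary.Decidable using (T?; decidable-stable)
open import Relation.Binary.PropositionalEquality

satisfied : PAss → Lit → Bool
satisfied φ x = isTrue (litVal φ x)

unfalsified : PAss → Lit → Bool
unfalsified φ x = not (isFalse (litVal φ x))

infixr 5 _▷_
_▷_ : PAss → PAss → PAss
(φ ▷ ψ) u = φ u <∣> ψ u

litVal-▷ : ∀ φ ψ x → litVal (φ ▷ ψ) x ≡ litVal φ x <∣> litVal ψ x
litVal-▷ φ ψ x with φ (var x)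
... | just _  = refl
... | nothing = refl

module _ (φ ψ : PAss) where

  any-satisfied-▷ : ∀ C → any (satisfied φ) C ≡ true → any (satisfied (φ ▷ ψ)) C ≡ true
  any-satisfied-▷ (x ∷ C) h rewrite litVal-▷ φ ψ x with litVal φ x
  ... | just true  = refl
  ... | just false = any-satisfied-▷ C h
  ... | nothing rewrite any-satisfied-▷ C h = ∨-zeroʳ _

  any-satisfied-▷-reduct : ∀ C → any (satisfied φ) C ≡ false →
                           any (satisfied ψ) (filterᵇ (unfalsified φ) C) ≡ any (satisfied (φ ▷ ψ)) C
  any-satisfied-▷-reduct []      _ = refl
  any-satisfied-▷-reduct (x ∷ C) h rewrite litVal-▷ φ ψ x with litVal φ x
  ... | just false = any-satisfied-▷-reduct C h
  ... | nothing    = cong (isTrue (litVal ψ x) ∨_) (any-satisfied-▷-reduct C h)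

  filter-unfalsified-▷ : ∀ C → any (satisfied φ) C ≡ false →
                         filterᵇ (unfalsified ψ) (filterᵇ (unfalsified φ) C) ≡ filterᵇ (unfalsified (φ ▷ ψ)) C
  filter-unfalsified-▷ []      _ = refl
  filter-unfalsified-▷ (x ∷ C) h rewrite litVal-▷ φ ψ x with litVal φ x
  ... | just false = filter-unfalsified-▷ C h
  ... | nothing with unfalsified ψ x
  ...   | true  = cong (x ∷_) (filter-unfalsified-▷ C h)
  ...   | false = filter-unfalsified-▷ C h

  *-▷ : ∀ F → ψ * (φ * F) ≡ (φ ▷ ψ) * F
  *-▷ []      = refl
  *-▷ (C ∷ F) with any (satisfied φ) C in e
  ... | true rewrite any-satisfied-▷ C e = *-▷ F
  ... | false rewrite any-satisfied-▷-reduct C e with any (satisfied (φ ▷ ψ)) C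
  ...   | true  = *-▷ F
  ...   | false = cong₂ _∷_ (filter-unfalsified-▷ C e) (*-▷ F)

filterᵇ-cong : ∀ {A : Set} {p q : A → Bool} → p ≗ q → filterᵇ p ≗ filterᵇ q
filterᵇ-cong p≗q = filter-≐ (T? ∘ _) (T? ∘ _) ((λ {x} → subst T (p≗q x)) , (λ {x} → subst T (sym (p≗q x))))

litVal-cong : ∀ {φ φ′} → φ ≗ φ′ → ∀ x → litVal φ x ≡ litVal φ′ x
litVal-cong {φ} {φ′} φ≗φ′ x with φ (var x) | φ′ (var x) | φ≗φ′ (var x)
... | just _  | _ | refl = refl
... | nothing | _ | refl = refl

*-cong : ∀ {φ φ′} → φ ≗ φ′ → ∀ F → φ * F ≡ φ′ * F
*-cong {φ} {φ′} φ≗φ′ F = begin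
  map (filterᵇ (unfalsified φ)) (filterᵇ (not ∘ any (satisfied φ)) F)
    ≡⟨ cong (map _) (filterᵇ-cong (λ C → cong (not ∘ or) (map-cong (cong isTrue ∘ same) C)) F) ⟩
  map (filterᵇ (unfalsified φ)) (filterᵇ (not ∘ any (satisfied φ′)) F)
    ≡⟨ map-cong (filterᵇ-cong (cong (not ∘ isFalse) ∘ same)) _ ⟩
  map (filterᵇ (unfalsified φ′)) (filterᵇ (not ∘ any (satisfied φ′)) F) ∎
  where
  open ≡-Reasoning
  same = litVal-cong φ≗φ′

infix 4 _⊑_
_⊑_ : PAss → PAss → Set
φ ⊑ φ′ = ∀ u {b} → φ u ≡ just b → φ′ u ≡ just b

⊑-▷ : ∀ {φ} φ′ ψ → φ ⊑ φ′ → φ ⊑ φ′ ▷ ψ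
⊑-▷ φ′ ψ φ⊑φ′ u e rewrite φ⊑φ′ u e = refl

_∖_ : PAss → PAss → PAss
(φ′ ∖ φ) u with φ u
... | just _  = nothing
... | nothing = φ′ u

▷-∖ : ∀ {φ φ′} → φ ⊑ φ′ → (φ ▷ φ′ ∖ φ) ≗ φ′
▷-∖ {φ} φ⊑φ′ u with φ u in e
... | just _  = sym (φ⊑φ′ u e)
... | nothing = refl

extend : PAss → (ℕ → Bool) → ℕ → Bool
extend φ g u = fromMaybe (g u) (φ u)

Agrees : PAss → (ℕ → Bool) → Set
Agrees φ g = ∀ u {b} → φ u ≡ just b → g u ≡ b

Allows : PAss → ℕ → Bool → Set
Allows φ v b = φ v ≡ nothing ⊎ φ v ≡ just b

Agrees-extend : ∀ φ g → Agrees φ (extend φ g)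
Agrees-extend φ g u φu≡b rewrite φu≡b = refl

Allows-Agrees : ∀ {φ g} → Agrees φ g → ∀ v → Allows φ v (g v)
Allows-Agrees {φ} ag v with φ v in e
... | nothing = inj₁ refl
... | just b  = inj₂ (cong just (sym (ag v e)))

Agrees-⊑ : ∀ {φ φ′ g} → φ ⊑ φ′ → Agrees φ′ g → Agrees φ g
Agrees-⊑ φ⊑φ′ ag u = ag u ∘ φ⊑φ′ u

module _ {φ : PAss} {g : ℕ → Bool} where

  TrueLit⇒unfalsified : Agrees φ g → ∀ {l} → TrueLit g l → T (unfalsified φ l)
  TrueLit⇒unfalsified ag {l} t with φ (var l) in e
  ... | nothing = _
  ... | just b rewrite sym (ag _ e) | t = _

  TrueLit-extend-satisfied : ∀ {l} → T (satisfied φ l) → TrueLit (extend φ g) l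
  TrueLit-extend-satisfied {l} s with φ (var l)
  ... | just b with b xor neg l
  ...   | true = refl

  TrueLit-extend-unfalsified : ∀ {l} → T (unfalsified φ l) → TrueLit g l → TrueLit (extend φ g) l
  TrueLit-extend-unfalsified {l} k t with φ (var l)
  ... | nothing = t
  ... | just b with b xor neg l
  ...   | true = refl

  Any-TrueLit-reduct : Agrees φ g → ∀ {C} → Any (TrueLit g) C → Any (TrueLit g) (filterᵇ (unfalsified φ) C)
  Any-TrueLit-reduct ag {x ∷ C} (here t) with unfalsified φ x | TrueLit⇒unfalsified ag t
  ... | true | _ = here t
  Any-TrueLit-reduct ag {x ∷ C} (there a) with unfalsified φ x
  ... | true  = there (Any-TrueLit-reduct ag a)
  ... | false = Any-TrueLit-reduct ag a

  Any-TrueLit-extend : ∀ {C} → Any (TrueLit g) (filterᵇ (unfalsified φ) C) → Any (TrueLit (extend φ g)) C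
  Any-TrueLit-extend a with find a
  ... | l , l∈ , t with ∈-filter⁻ (T? ∘ unfalsified φ) l∈
  ...   | l∈C , k = lose l∈C (TrueLit-extend-unfalsified k t)

  Satisfies-* : Agrees φ g → ∀ {F} → Satisfies g F → Satisfies g (φ * F)
  Satisfies-* ag s = All.map⁺ (All.filter⁺ _ (All.map (Any-TrueLit-reduct ag) s))

  Satisfies-extend : ∀ F → Satisfies g (φ * F) → Satisfies (extend φ g) F
  Satisfies-extend []      _ = []
  Satisfies-extend (C ∷ F) s with any (satisfied φ) C in e
  ... | true =
    Any.map TrueLit-extend-satisfied (Any.any⁻ (satisfied φ) C (subst T (sym e) _)) ∷ Satisfies-extend F s
  ... | false with s
  ...   | a ∷ s′ = Any-TrueLit-extend a ∷ Satisfies-extend F s′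

-- ⟨ x ↦1⟩ is definitionally var x ≔ not (neg x), and ⟨ mkLit v c ↦0⟩ is v ≔ c.
infix 6 _≔_
_≔_ : ℕ → Bool → PAss
(v ≔ c) u = if u ≡ᵇ v then just c else nothing

≔-self : ∀ v c → (v ≔ c) v ≡ just c
≔-self v c with v ≡ᵇ v | ≡⇒≡ᵇ v v refl
... | true | _ = refl

≔-just : ∀ {v c u b} → (v ≔ c) u ≡ just b → u ≡ v × c ≡ b
≔-just {v} {c} {u} e with u ≡ᵇ v | ≡ᵇ⇒≡ u v
... | true | u≡v with refl ← e = u≡v _ , refl

≔-other : ∀ {v c u} → ¬ u ≡ v → (v ≔ c) u ≡ nothing
≔-other {v} {c} {u} u≢v with u ≡ᵇ v | ≡ᵇ⇒≡ u v
... | false | _   = refl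
... | true  | u≡v = ⊥-elim (u≢v (u≡v _))

extend-≔-self : ∀ g v c → extend (v ≔ c) g v ≡ c
extend-≔-self g v c rewrite ≔-self v c = refl

extend-≔-other : ∀ g {v c u} → ¬ u ≡ v → extend (v ≔ c) g u ≡ g u
extend-≔-other g {v} {c} u≢v rewrite ≔-other {v} {c} u≢v = refl

Agrees-extend-≔ : ∀ {φ g} v b → Agrees φ g → Allows φ v b → Agrees φ (extend (v ≔ b) g)
Agrees-extend-≔ {φ} {g} v b ag allows u e with u ≟ v
... | no u≢v rewrite extend-≔-other g {v} {b} u≢v = ag u e
... | yes refl rewrite extend-≔-self g v b with allows
...   | inj₁ free     = case trans (sym free) e of λ ()
...   | inj₂ assigned = just-injective (trans (sym assigned) e)

Agrees-▷-≔ : ∀ {φ g} v c → Agrees φ g → (φ v ≡ nothing → g v ≡ c) → Agrees (φ ▷ v ≔ c) g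
Agrees-▷-≔ {φ} {g} v c ag free u e with φ u in eφ
... | just _ with refl ← e = ag u eφ
... | nothing with ≔-just {v} {c} {u} e
...   | refl , refl = free eφ

satisfied-unit : ∀ x → satisfied ⟨ x ↦1⟩ x ≡ true
satisfied-unit x rewrite ≔-self (var x) (not (neg x)) with neg x
... | true  = refl
... | false = refl

unit-shrinks : ∀ {x F} → (x ∷ []) ∈ F → length (⟨ x ↦1⟩ * F) < length F
unit-shrinks {x} {F} x∈F
  rewrite length-map (filterᵇ (unfalsified ⟨ x ↦1⟩)) (filterᵇ (not ∘ any (satisfied ⟨ x ↦1⟩)) F) =
  filter-notAll (T? ∘ _) F (Any.map (λ { refl → unit-satisfied }) x∈F)
  where
  unit-satisfied : ¬ T (not (any (satisfied ⟨ x ↦1⟩) (x ∷ [])))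
  unit-satisfied rewrite satisfied-unit x = λ ()

Implied : ClauseSet → PAss → PAss → Set
Implied G φ φ′ = ∀ g → Agrees φ g → Satisfies g G → Agrees φ′ g

Stable : ClauseSet → Set
Stable F = any null F ≡ false × findUnit F ≡ nothing

data R1Outcome (G : ClauseSet) (φ : PAss) : ClauseSet → Set where
  conflict : ∀ {φ′} → Implied G φ φ′ → [] ∈ φ′ * G → R1Outcome G φ ⊥set
  stable   : ∀ {φ′} → φ ⊑ φ′ → Implied G φ φ′ → Stable (φ′ * G) → R1Outcome G φ (φ′ * G)

∈-findUnit : ∀ F {x} → findUnit F ≡ just x → (x ∷ []) ∈ F
∈-findUnit ([] ∷ F)          e    = there (∈-findUnit F e)
∈-findUnit ((_ ∷ []) ∷ F)    refl = here refl
∈-findUnit ((_ ∷ _ ∷ _) ∷ F) e    = there (∈-findUnit F e)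

∈-any-null : ∀ F → any (null {A = Lit}) F ≡ true → [] ∈ F
∈-any-null ([] ∷ F)      _ = here refl
∈-any-null ((_ ∷ _) ∷ F) e = there (∈-any-null F e)

Implied-unit : ∀ {G φ φc x} → Implied G φ φc → (x ∷ []) ∈ φc * G → Implied G φ (φc ▷ ⟨ x ↦1⟩)
Implied-unit {x = x} imp x∈ g ag sat =
  Agrees-▷-≔ (var x) (not (neg x)) (imp g ag sat) (λ _ → unit-value unit-true)
  where
  unit-true : Any (TrueLit g) (x ∷ [])
  unit-true = All.lookup (Satisfies-* (imp g ag sat) sat) x∈
  unit-value : Any (TrueLit g) (x ∷ []) → g (var x) ≡ not (neg x)
  unit-value (here t) with g (var x) | neg x
  ... | true  | false = refl
  ... | false | true  = refl

r1-fuel-outcome : ∀ G {φ φc} k → φ ⊑ φc → Implied G φ φc → length (φc * G) < k →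
                  R1Outcome G φ (r1-fuel k (φc * G))
r1-fuel-outcome G {φ} {φc} (suc k) φ⊑φc imp len<k with any null (φc * G) in nul
... | true = conflict imp (∈-any-null (φc * G) nul)
... | false with findUnit (φc * G) in unit
...   | nothing = stable φ⊑φc imp (nul , unit)
...   | just x  = subst (R1Outcome G φ) (cong (r1-fuel k) (sym (*-▷ φc ⟨ x ↦1⟩ G)))
                    (r1-fuel-outcome G k (⊑-▷ φc ⟨ x ↦1⟩ φ⊑φc) (Implied-unit imp x∈) len′<k)
  where
  x∈ = ∈-findUnit (φc * G) unit
  len′<k : length ((φc ▷ ⟨ x ↦1⟩) * G) < k
  len′<k rewrite sym (*-▷ φc ⟨ x ↦1⟩ G) = <-≤-trans (unit-shrinks x∈) (≤-pred len<k)

r1-outcome : ∀ G φ → R1Outcome G φ (r1 (φ * G))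
r1-outcome G φ = r1-fuel-outcome G (suc (length (φ * G))) (λ _ e → e) (λ _ ag _ → ag) ≤-refl

≢⇒T-xor : ∀ {a b} → ¬ a ≡ b → T (a xor b)
≢⇒T-xor {false} {false} a≢b = a≢b refl
≢⇒T-xor {false} {true}  _   = _
≢⇒T-xor {true}  {false} _   = _
≢⇒T-xor {true}  {true}  a≢b = a≢b refl

xorVars : (ℕ → Bool) → List ℕ → Bool
xorVars g vs = foldr _xor_ false (map g vs)

-- ⊕_{x ∈ D} x = 0, with the complemented literals moved to the right-hand side.
XorSat : (ℕ → Bool) → Clause → Set
XorSat g D = xorVars g (vars D) ≡ parity D

SolvesXor : List Clause → (ℕ → Bool) → Set
SolvesXor L g = All (XorSat g) L

parity-falsified : ∀ g E → All (¬_ ∘ TrueLit g) E → parity E ≡ xorVars g (vars E)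
parity-falsified g []      []          = refl
parity-falsified g (l ∷ E) (¬t ∷ ¬ts) = cong₂ _xor_ (neg-value (g (var l)) (neg l) ¬t) (parity-falsified g E ¬ts)
  where
  neg-value : ∀ a n → ¬ (a xor n) ≡ true → n ≡ a
  neg-value false false _ = refl
  neg-value true  true  _ = refl
  neg-value false true  t = ⊥-elim (t refl)
  neg-value true  false t = ⊥-elim (t refl)

∈-allClauses⁻ : ∀ {E} vs → E ∈ allClauses vs → vars E ≡ vs
∈-allClauses⁻ []       (here refl) = refl
∈-allClauses⁻ (v ∷ vs) E∈ with find (∈-concatMap⁻ _ {xs = allClauses vs} E∈)
... | D , D∈ , here refl         = cong (v ∷_) (∈-allClauses⁻ vs D∈)
... | D , D∈ , there (here refl) = cong (v ∷_) (∈-allClauses⁻ vs D∈)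

∈-allClauses⁺ : ∀ E → E ∈ allClauses (vars E)
∈-allClauses⁺ []               = here refl
∈-allClauses⁺ (mkLit v n ∷ E) = ∈-concatMap⁺ _ {xs = allClauses (vars E)} (lose (∈-allClauses⁺ E) (either n))
  where
  either : ∀ n → (mkLit v n ∷ E) ∈ (mkLit v false ∷ E) ∷ (mkLit v true ∷ E) ∷ []
  either false = here refl
  either true  = there (here refl)

∈-X0c⁻ : ∀ {E D} → E ∈ X0c D → vars E ≡ vars D × T (parity E xor parity D)
∈-X0c⁻ {D = D} E∈ with ∈-filter⁻ (T? ∘ _) {xs = allClauses (vars D)} E∈
... | E∈all , odd = ∈-allClauses⁻ (vars D) E∈all , odd

∈-X0c⁺ : ∀ {E D} → vars E ≡ vars D → T (parity E xor parity D) → E ∈ X0c D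
∈-X0c⁺ {E} same-vars odd = ∈-filter⁺ (T? ∘ _) (subst (λ vs → E ∈ allClauses vs) same-vars (∈-allClauses⁺ E)) odd

XorSat⇒Satisfies-X0c : ∀ g D → XorSat g D → Satisfies g (X0c D)
XorSat⇒Satisfies-X0c g D sat = All.tabulate clause-true
  where
  clause-true : ∀ {E} → E ∈ X0c D → Any (TrueLit g) E
  clause-true {E} E∈ with Any.any? (λ l → g (var l) xor neg l Bool.≟ true) E
  ... | yes t  = t
  ... | no  ¬t = ⊥-elim (subst T (trans (cong (_xor parity D) parity-E≡D) (xor-same (parity D))) odd)
    where
    same-vars-odd = ∈-X0c⁻ {E} {D} E∈
    odd = proj₂ same-vars-odd
    parity-E≡D : parity E ≡ parity D
    parity-E≡D = trans (parity-falsified g E (¬Any⇒All¬ E ¬t)) (trans (cong (xorVars g) (proj₁ same-vars-odd)) sat)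

Satisfies-X0 : ∀ g L → SolvesXor L g → Satisfies g (X0 L)
Satisfies-X0 g L sats = All.tabulate λ E∈ →
  let D , D∈L , E∈X0c = find (∈-concatMap⁻ X0c {xs = L} E∈)
  in All.lookup (XorSat⇒Satisfies-X0c g D (All.lookup sats D∈L)) E∈X0c

freeVars : PAss → Clause → List ℕ
freeVars φ D = filterᵇ (is-nothing ∘ φ) (vars D)

Propagated : PAss → Clause → Set
Propagated φ D = ∀ g → Agrees φ g → length (freeVars φ D) ≤ 1 → XorSat g D

falsified : (ℕ → Bool) → Clause → Clause
falsified g D = map (λ l → mkLit (var l) (g (var l))) D

vars-falsified : ∀ g D → vars (falsified g D) ≡ vars D
vars-falsified g D = sym (map-∘ D)

falsified-false : ∀ g D → All (¬_ ∘ TrueLit g) (falsified g D)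
falsified-false g D = All.map⁺ (All.tabulate λ {l} _ → self-xor-false (g (var l)))
  where
  self-xor-false : ∀ a → ¬ (a xor a) ≡ true
  self-xor-false false ()
  self-xor-false true  ()

module _ {φ : PAss} {g : ℕ → Bool} (ag : Agrees φ g) where

  falsified-unsatisfied : ∀ D → any (satisfied φ) (falsified g D) ≡ false
  falsified-unsatisfied []      = refl
  falsified-unsatisfied (l ∷ D) with φ (var l) in e
  ... | nothing = falsified-unsatisfied D
  ... | just b rewrite ag _ e | xor-same b = falsified-unsatisfied D

  length-reduct-falsified : ∀ D → length (filterᵇ (unfalsified φ) (falsified g D)) ≡ length (freeVars φ D)
  length-reduct-falsified []      = refl
  length-reduct-falsified (l ∷ D) with φ (var l) in e
  ... | nothing = cong suc (length-reduct-falsified D)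
  ... | just b rewrite ag _ e | xor-same b = length-reduct-falsified D

Stable-no-short-clause : ∀ {F C} → Stable F → C ∈ F → length C ≤ 1 → ⊥
Stable-no-short-clause {F} {[]} (no-empty , _) C∈ _ =
  subst T no-empty (Any.any⁺ null (Any.map (λ { refl → _ }) C∈))
Stable-no-short-clause {F} {x ∷ []} (_ , no-unit) C∈ _ = unit-found F C∈ no-unit
  where
  unit-found : ∀ F → (x ∷ []) ∈ F → findUnit F ≡ nothing → ⊥
  unit-found ((_ ∷ []) ∷ F)    (here refl) ()
  unit-found ((_ ∷ []) ∷ F)    (there _)   ()
  unit-found ([] ∷ F)          (there x∈)  e = unit-found F x∈ e
  unit-found ((_ ∷ _ ∷ _) ∷ F) (there x∈)  e = unit-found F x∈ e
Stable-no-short-clause {C = _ ∷ _ ∷ _} _ _ (s≤s ())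

Stable⇒Propagated : ∀ {φ} L → Stable (φ * X0 L) → All (Propagated φ) L
Stable⇒Propagated {φ} L F-stable = All.tabulate (λ {D} → propagated D)
  where
  -- An extension violating D falsifies the clause falsified g D of X₀(D), whose reduct under φ
  -- keeps just the free variables of D.
  propagated : ∀ D → D ∈ L → ∀ g → Agrees φ g → length (freeVars φ D) ≤ 1 → XorSat g D
  propagated D D∈L g ag few with xorVars g (vars D) Bool.≟ parity D
  ... | yes sat = sat
  ... | no ¬sat =
    ⊥-elim (Stable-no-short-clause F-stable E′∈ (subst (_≤ 1) (sym (length-reduct-falsified ag D)) few))
    where
    E = falsified g D
    odd : T (parity E xor parity D)
    odd rewrite parity-falsified g E (falsified-false g D) | vars-falsified g D = ≢⇒T-xor ¬sat
    E∈X0 : E ∈ X0 L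
    E∈X0 = ∈-concatMap⁺ X0c {xs = L} (lose D∈L (∈-X0c⁺ {E} {D} (vars-falsified g D) odd))
    E′∈ : filterᵇ (unfalsified φ) E ∈ φ * X0 L
    E′∈ = ∈-map⁺ _ (∈-filter⁺ (T? ∘ _) E∈X0 (subst (T ∘ not) (sym (falsified-unsatisfied ag D)) _))

record Solution (φ : PAss) (P : (ℕ → Bool) → Set) (v : ℕ) (b : Bool) : Set where
  constructor solution
  field
    assignment : ℕ → Bool
    agrees     : Agrees φ assignment
    satisfies  : P assignment
    pinned     : assignment v ≡ b

Flexible : PAss → ((ℕ → Bool) → Set) → Set
Flexible φ P = ∀ v b → Allows φ v b → Solution φ P v b

Flexible-map : ∀ {φ} {P Q : (ℕ → Bool) → Set} → (∀ {g} → P g → Q g) → Flexible φ P → Flexible φ Q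
Flexible-map P⇒Q flex v b allows =
  let solution g ag sat pin = flex v b allows in solution g ag (P⇒Q sat) pin

some-solution : ∀ {φ P} → Flexible φ P → Solution φ P 0 (fromMaybe false (φ 0))
some-solution {φ} flex with φ 0 in e
... | nothing = flex 0 false (inj₁ e)
... | just b  = flex 0 b (inj₂ e)

xorVars-cong : ∀ {g g′} vs → (∀ {u} → u ∈ vs → g u ≡ g′ u) → xorVars g vs ≡ xorVars g′ vs
xorVars-cong vs same = cong (foldr _xor_ false) (map-cong-local (All.tabulate same))

xorVars-flip : ∀ g {w} vs → Unique vs → w ∈ vs →
               xorVars (extend (w ≔ not (g w)) g) vs ≡ not (xorVars g vs)
xorVars-flip g (v ∷ vs) (v∉vs ∷ _) (here refl) =
  trans (cong₂ _xor_ (extend-≔-self g v _) (xorVars-cong vs λ u∈ → extend-≔-other g (All.lookup v∉vs u∈ ∘ sym)))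
        (sym (not-distribˡ-xor (g v) (xorVars g vs)))
xorVars-flip g (v ∷ vs) (v∉vs ∷ uvs) (there w∈) =
  trans (cong₂ _xor_ (extend-≔-other g (All.lookup v∉vs w∈)) (xorVars-flip g vs uvs w∈))
        (sym (not-distribʳ-xor (g v) (xorVars g vs)))

T-is-nothing : ∀ {m : Maybe Bool} → T (is-nothing m) → m ≡ nothing
T-is-nothing {nothing} _ = refl

Unique-constant⇒length≤1 : ∀ {v} {xs : List ℕ} → Unique xs → All (_≡ v) xs → length xs ≤ 1
Unique-constant⇒length≤1 {xs = []}        _               _               = z≤n
Unique-constant⇒length≤1 {xs = _ ∷ []}    _               _               = s≤s z≤n
Unique-constant⇒length≤1 {xs = _ ∷ _ ∷ _} ((x≢y ∷ _) ∷ _) (x≡v ∷ y≡v ∷ _) = ⊥-elim (x≢y (trans x≡v (sym y≡v)))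

flexible-single : ∀ {φ D} → Unique (vars D) → Propagated φ D → Flexible φ (SolvesXor (D ∷ []))
flexible-single {φ} {D} uD prop v b allows = adjust (xorVars g₀ (vars D) Bool.≟ parity D)
  where
  base = extend φ (λ _ → false)
  g₀ = extend (v ≔ b) base
  ag₀ : Agrees φ g₀
  ag₀ = Agrees-extend-≔ v b (Agrees-extend φ (λ _ → false)) allows
  adjust : Dec (XorSat g₀ D) → Solution φ (SolvesXor (D ∷ [])) v b
  adjust (yes sat) = solution g₀ ag₀ (sat ∷ []) (extend-≔-self base v b)
  -- If g₀ violates D, flip a free variable other than v; there is one, as otherwise D has at
  -- most one free variable.
  adjust (no ¬sat) with Any.any? (λ w → ¬? (w ≟ v)) (freeVars φ D)
  ... | yes other =
    let w , w∈free , w≢v = find other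
        w∈D , w-free     = ∈-filter⁻ (T? ∘ _) {xs = vars D} w∈free
    in solution (extend (w ≔ not (g₀ w)) g₀)
                (Agrees-extend-≔ w (not (g₀ w)) ag₀ (inj₁ (T-is-nothing w-free)))
                (trans (xorVars-flip g₀ (vars D) uD w∈D) (sym (¬-not (¬sat ∘ sym))) ∷ [])
                (trans (extend-≔-other g₀ (w≢v ∘ sym)) (extend-≔-self base v b))
  ... | no none =
    ⊥-elim (¬sat (prop g₀ ag₀ (Unique-constant⇒length≤1 (filter⁺ (T? ∘ _) uD)
                                  (All.map (decidable-stable (_ ≟ v)) (¬Any⇒All¬ _ none)))))

varsOf : List Clause → List ℕ
varsOf = concatMap vars

SolvesXor-cong : ∀ {g g′} S → (∀ {u} → u ∈ varsOf S → g u ≡ g′ u) → SolvesXor S g → SolvesXor S g′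
SolvesXor-cong []      _    []           = []
SolvesXor-cong (D ∷ S) same (sat ∷ sats) =
  trans (sym (xorVars-cong (vars D) (same ∘ ∈-++⁺ˡ))) sat ∷ SolvesXor-cong S (same ∘ ∈-++⁺ʳ (vars D)) sats

merge : List ℕ → (ℕ → Bool) → (ℕ → Bool) → ℕ → Bool
merge vs g₁ g₂ u = if does (u ∈? vs) then g₂ u else g₁ u

module _ (vs : List ℕ) (g₁ g₂ : ℕ → Bool) where

  merge-∈ : ∀ {u} → u ∈ vs → merge vs g₁ g₂ u ≡ g₂ u
  merge-∈ {u} u∈ with u ∈? vs
  ... | yes _  = refl
  ... | no u∉ = ⊥-elim (u∉ u∈)

  merge-∉ : ∀ {u} → ¬ u ∈ vs → merge vs g₁ g₂ u ≡ g₁ u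
  merge-∉ {u} u∉ with u ∈? vs
  ... | yes u∈ = ⊥-elim (u∉ u∈)
  ... | no _   = refl

  Agrees-merge : ∀ {φ} → Agrees φ g₁ → Agrees φ g₂ → Agrees φ (merge vs g₁ g₂)
  Agrees-merge ag₁ ag₂ u with u ∈? vs
  ... | yes _ = ag₂ u
  ... | no _  = ag₁ u

-- Solve the system containing the pinned variable first, then the other one with the value this
-- gives y, and merge the two solutions.
glue : ∀ {φ} S T y → (∀ {u} → u ∈ varsOf S → u ∈ varsOf T → u ≡ y) →
       Flexible φ (SolvesXor S) → Flexible φ (SolvesXor T) → Flexible φ (SolvesXor (S ++ T))
glue {φ} S T y shared flexS flexT v b allows = pick (v ∈? varsOf T)
  where
  combine : ∀ {g₁ g₂} → g₁ y ≡ g₂ y → Agrees φ g₁ → Agrees φ g₂ → SolvesXor S g₁ → SolvesXor T g₂ →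
            merge (varsOf T) g₁ g₂ v ≡ b → Solution φ (SolvesXor (S ++ T)) v b
  combine {g₁} {g₂} y-same ag₁ ag₂ sat₁ sat₂ pin =
    solution (merge (varsOf T) g₁ g₂) (Agrees-merge (varsOf T) g₁ g₂ ag₁ ag₂)
             (All.++⁺ (SolvesXor-cong S same₁ sat₁) (SolvesXor-cong T (sym ∘ merge-∈ (varsOf T) g₁ g₂) sat₂)) pin
    where
    same₁ : ∀ {u} → u ∈ varsOf S → g₁ u ≡ merge (varsOf T) g₁ g₂ u
    same₁ {u} u∈S with u ∈? varsOf T
    ... | yes u∈T rewrite shared u∈S u∈T = y-same
    ... | no _    = refl
  pick : Dec (v ∈ varsOf T) → Solution φ (SolvesXor (S ++ T)) v b
  pick (yes v∈T) =
    let solution g₂ ag₂ sat₂ pin₂ = flexT v b allows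
        solution g₁ ag₁ sat₁ pin₁ = flexS y (g₂ y) (Allows-Agrees ag₂ y)
    in combine pin₁ ag₁ ag₂ sat₁ sat₂ (trans (merge-∈ (varsOf T) g₁ g₂ v∈T) pin₂)
  pick (no v∉T) =
    let solution g₁ ag₁ sat₁ pin₁ = flexS v b allows
        solution g₂ ag₂ sat₂ pin₂ = flexT y (g₁ y) (Allows-Agrees ag₁ y)
    in combine (sym pin₂) ag₁ ag₂ sat₁ sat₂ (trans (merge-∉ (varsOf T) g₁ g₂ v∉T) pin₁)

chain : Lit → List Lit → List ℕ → List Clause
chain z (x ∷ xs) (y ∷ ys) = (z ∷ x ∷ pos y ∷ []) ∷ splitChain y xs ys
chain z (x ∷ []) []       = (z ∷ x ∷ []) ∷ []
chain _ _        _        = []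

splitChain-chain : ∀ y xs ys → splitChain y xs ys ≡ chain (pos y) xs ys
splitChain-chain y []          _       = refl
splitChain-chain y (_ ∷ [])    []      = refl
splitChain-chain y (_ ∷ [])    (_ ∷ _) = refl
splitChain-chain y (_ ∷ _ ∷ _) []      = refl
splitChain-chain y (_ ∷ _ ∷ _) (_ ∷ _) = refl

natSplit-chain : ∀ a b rest ys → length ys ≡ length rest → natSplit (a ∷ b ∷ rest) ys ≡ chain a (b ∷ rest) ys
natSplit-chain a b []      []      _ = refl
natSplit-chain a b (_ ∷ _) (_ ∷ _) _ = refl

varsOf-chain : ∀ z xs ys {u} → u ∈ varsOf (chain z xs ys) → u ∈ var z ∷ vars xs ⊎ u ∈ ys
varsOf-chain z (x ∷ []) []       (here e)                 = inj₁ (here e)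
varsOf-chain z (x ∷ []) []       (there (here e))         = inj₁ (there (here e))
varsOf-chain z (x ∷ xs) (y ∷ ys) (here e)                 = inj₁ (here e)
varsOf-chain z (x ∷ xs) (y ∷ ys) (there (here e))         = inj₁ (there (here e))
varsOf-chain z (x ∷ xs) (y ∷ ys) (there (there (here e))) = inj₂ (here e)
varsOf-chain z (x ∷ xs) (y ∷ ys) (there (there (there u∈)))
  with varsOf-chain (pos y) xs ys (subst (λ L → _ ∈ varsOf L) (splitChain-chain y xs ys) u∈)
... | inj₁ (here e)   = inj₂ (here e)
... | inj₁ (there u∈) = inj₁ (there (there u∈))
... | inj₂ u∈         = inj₂ (there u∈)

flexible-chain : ∀ {φ} z xs ys → length xs ≡ suc (length ys) →
                 Unique (var z ∷ vars xs) → Unique ys → All (_∉ var z ∷ vars xs) ys →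
                 All (Propagated φ) (chain z xs ys) → Flexible φ (SolvesXor (chain z xs ys))
flexible-chain z (x ∷ []) [] _ uzx _ _ (prop ∷ []) = flexible-single uzx prop
flexible-chain {φ} z (x ∷ xs) (y ∷ ys) len ((z∉xxs ∷ (x∉xs ∷ uxs))) (y∉ys ∷ uys) (y∉zxs ∷ ys∉zxs)
               (propH ∷ props) =
  glue (H ∷ []) (splitChain y xs ys) y shared (flexible-single uH propH)
       (subst (Flexible φ ∘ SolvesXor) (sym rest≡)
              (flexible-chain (pos y) xs ys (suc-injective len) uyxs uys ys∉yxs (subst (All (Propagated φ)) rest≡ props)))
  where
  H = z ∷ x ∷ pos y ∷ []
  rest≡ = splitChain-chain y xs ys
  zx⊆zxs : ∀ {u} → u ∈ var z ∷ var x ∷ [] → u ∈ var z ∷ var x ∷ vars xs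
  zx⊆zxs (here e)         = here e
  zx⊆zxs (there (here e)) = there (here e)
  uH : Unique (vars H)
  uH = (All.head z∉xxs ∷ (y∉zxs ∘ here ∘ sym) ∷ []) ∷ ((y∉zxs ∘ there ∘ here ∘ sym) ∷ []) ∷ [] ∷ []
  uyxs : Unique (y ∷ vars xs)
  uyxs = ¬Any⇒All¬ _ (y∉zxs ∘ there ∘ there) ∷ uxs
  ys∉yxs : All (_∉ y ∷ vars xs) ys
  ys∉yxs = All.zipWith (λ { (y≢y′ , y′∉zxs) (here e)  → y≢y′ (sym e)
                           ; (y≢y′ , y′∉zxs) (there m) → y′∉zxs (there (there m)) }) (y∉ys , ys∉zxs)
  zx∉xs : ∀ {u} → u ∈ var z ∷ var x ∷ [] → u ∉ vars xs
  zx∉xs (here refl)         = All¬⇒¬Any (All.tail z∉xxs)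
  zx∉xs (there (here refl)) = All¬⇒¬Any x∉xs
  clash : ∀ {u} → u ∈ var z ∷ var x ∷ [] → ¬ u ∈ varsOf (splitChain y xs ys)
  clash {u} u∈zx u∈rest with varsOf-chain (pos y) xs ys (subst (λ L → u ∈ varsOf L) rest≡ u∈rest)
  ... | inj₁ (here u≡y)   = y∉zxs (subst (_∈ _) u≡y (zx⊆zxs u∈zx))
  ... | inj₁ (there u∈xs) = zx∉xs u∈zx u∈xs
  ... | inj₂ u∈ys         = All.lookup ys∉zxs u∈ys (zx⊆zxs u∈zx)
  shared : ∀ {u} → u ∈ varsOf (H ∷ []) → u ∈ varsOf (splitChain y xs ys) → u ≡ y
  shared (here e)                 u∈rest = ⊥-elim (clash (here e) u∈rest)
  shared (there (here e))         u∈rest = ⊥-elim (clash (there (here e)) u∈rest)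
  shared (there (there (here e))) _      = e

flexible-natSplit : ∀ {φ} C ys → Unique (vars C) → length ys ≡ length C ∸ 2 → Unique ys → All (_∉ vars C) ys →
                    All (Propagated φ) (natSplit C ys) → Flexible φ (SolvesXor (natSplit C ys))
flexible-natSplit []       _  uC _ _ _ (prop ∷ []) = flexible-single uC prop
flexible-natSplit (_ ∷ []) _  uC _ _ _ (prop ∷ []) = flexible-single uC prop
flexible-natSplit {φ} (a ∷ b ∷ rest) ys uC len uys ys∉C props =
  subst (Flexible φ ∘ SolvesXor) (sym split≡)
        (flexible-chain a (b ∷ rest) ys (cong suc (sym len)) uC uys ys∉C (subst (All (Propagated φ)) split≡ props))
  where split≡ = natSplit-chain a b rest ys len

≐-reflexive : ∀ {F H} → F ≡ H → F ≐ H
≐-reflexive refl = same , same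
  where
  same : ∀ {F C} → C ∈ F → Any (C ≈c_) F
  same = Any.map λ { refl → (λ m → m) , (λ m → m) }

conflict-Unsat : ∀ {G φ φ′} → Implied G φ φ′ → [] ∈ φ′ * G → Unsat (φ * G)
conflict-Unsat {G} {φ} imp []∈ (f , sat) =
  case All.lookup (Satisfies-* (imp _ (Agrees-extend φ f) satG) satG) []∈ of λ ()
  where satG = Satisfies-extend G sat

module _ {G φ φ′} (φ⊑φ′ : φ ⊑ φ′) (imp : Implied G φ φ′) (flex : Flexible φ′ (λ g → Satisfies g G)) where

  Sat-≔ : ∀ {v c g} → Agrees φ′ g → Satisfies g G → (φ v ≡ nothing → g v ≡ c) → Sat ((v ≔ c) * (φ * G))
  Sat-≔ {v} {c} {g} ag satG pin =
    g , subst (Satisfies g) (sym (*-▷ φ (v ≔ c) G)) (Satisfies-* (Agrees-▷-≔ v c (Agrees-⊑ φ⊑φ′ ag) pin) satG)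

  forced-∖ : IsForcedAss (φ * G) (φ′ ∖ φ)
  forced-∖ v b = mk⇔ assigned⇒forced forced⇒assigned
    where
    assigned⇒forced : (φ′ ∖ φ) v ≡ just b → Forced (φ * G) (mkLit v (not b))
    assigned⇒forced ψv≡b (f , sat) with φ v in eφ
    ... | nothing = not-¬ refl (trans (sym g-b) g-¬b)
      where
      g = extend (φ ▷ v ≔ not b) f
      satG = Satisfies-extend G (subst (Satisfies f) (*-▷ φ (v ≔ not b) G) sat)
      g-b : g v ≡ b
      g-b = imp g (Agrees-⊑ (⊑-▷ φ (v ≔ not b) (λ _ e → e)) (Agrees-extend _ f)) satG v ψv≡b
      g-¬b : g v ≡ not b
      g-¬b = Agrees-extend (φ ▷ v ≔ not b) f v (trans (cong (_<∣> (v ≔ not b) v) eφ) (≔-self v (not b)))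
    Sat-if-allowed : Allows φ′ v (not b) → Sat ((v ≔ not b) * (φ * G))
    Sat-if-allowed allows = let solution g ag satG pin = flex v (not b) allows in Sat-≔ ag satG (λ _ → pin)
    forced⇒assigned : Forced (φ * G) (mkLit v (not b)) → (φ′ ∖ φ) v ≡ just b
    forced⇒assigned unsat with φ v in eφ
    ... | just _ = ⊥-elim (unsat (Sat-≔ ag satG (λ free → case trans (sym eφ) free of λ ())))
      where open Solution (some-solution flex) renaming (agrees to ag; satisfies to satG)
    ... | nothing with φ′ v in eφ′
    ...   | nothing = ⊥-elim (unsat (Sat-if-allowed (inj₁ eφ′)))
    ...   | just b′ with b′ Bool.≟ b
    ...     | yes refl = refl
    ...     | no b′≢b  = ⊥-elim (unsat (Sat-if-allowed (inj₂ (trans eφ′ (cong just (¬-not b′≢b))))))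

  stable-RInfIs : RInfIs (φ * G) (φ′ * G)
  stable-RInfIs =
    inj₂ (sat , φ′ ∖ φ , forced-∖ , ≐-reflexive (sym (trans (*-▷ φ (φ′ ∖ φ) G) (*-cong (▷-∖ φ⊑φ′) G))))
    where
    open Solution (some-solution flex)
    sat = assignment , Satisfies-* (Agrees-⊑ φ⊑φ′ agrees) satisfies

PC-criterion : ∀ G → (∀ φ → Stable (φ * G) → Flexible φ (λ g → Satisfies g G)) → PC G
PC-criterion G flexible φ with r1 (φ * G) | r1-outcome G φ
... | _ | conflict imp []∈       = inj₁ (conflict-Unsat imp []∈ , ≐-reflexive refl)
... | _ | stable φ⊑φ′ imp stable′ = stable-RInfIs φ⊑φ′ imp (flexible _ stable′)

lemma8p4 : (C : Clause) → Unique (vars C)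
         → (ys : List ℕ) → length ys ≡ length C ∸ 2 → Unique ys → All (_∉ vars C) ys
         → PC (X1 C ys)
lemma8p4 C uC ys len uys ys∉C = PC-criterion (X1 C ys) λ φ stable′ →
  Flexible-map (Satisfies-X0 _ (natSplit C ys))
    (flexible-natSplit C ys uC len uys ys∉C (Stable⇒Propagated (natSplit C ys) stable′))
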